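{- Let $(G,<,\mathbf{q})$ be a stable assignment instance, let $X$ be one side of the bipartition ($X=A$ or $X=B$) and $Y$ the other, and let $M\in\mathcal{S}(G,<,\mathbf{q})$. If $x\in X$ is a sink in the $X$-rotation digraph $D_X$ of $M$ and $(x',y),(y,x)$ are arcs of $D_X$, then $x'y$ is an illegal edge.
   Context: A stable assignment instance is $(G,<,\mathbf{q})$ with $G=(A\cup B,E)$ a finite simple bipartite graph (students $A$, schools $B$), $<_v$ a strict total order on the neighbours of each vertex $v$ (write $y>_x y'$ for strict preference, $y>_x\emptyset$ for each neighbour $y$), and positive integer quotas $q_b$, $b\in B$; set also $q_a=1$ for $a\in A$. An assignment is $M\subseteq E$ with each vertex $v$ in at most $q_v$ edges of $M$; $M(x)=\{y:xy\in M\}$. Edge $ab$ blocks $M$ if $b>_a M(a)$ and either $|M(b)|<q_b$ or $a>_b a'$ for some $a'\in M(b)$; an assignment blocks $M$ if one of its edges does; $M$ is stable if no edge of $G$ blocks it; $\mathcal{S}(G,<,\mathbf{q})$ is the set of stable assignments. A set $\mathcal{L}$ of assignments has the legal property if the assignments blocked by some member of $\mathcal{L}$ are exactly those not in $\mathcal{L}$; there is exactly one such set (the legal assignments), and an edge is illegal if it lies in no legal assignment. Rotation digraph: for stable $M$ and $x\in X$, $s_M(x)$ is the most preferred agent $y$ in $x$'s list with $y\notin M(x)$ and $x>_y x'$ for some $x'\in M(y)$ (it may not exist); if $y=s_M(x)$ exists and $|M(y)|=q_y$, $next_M(x)$ is the least preferred (under $<_y$) element of $M(y)$, and if $|M(y)|<q_y$,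 $next_M(x)=\emptyset$. The $X$-rotation digraph $D_X$ of $M$ has vertex set $X\cup Y\cup\{\emptyset\}$ and, for every $x\in X$ such that $s_M(x)$ exists, arcs $(x,s_M(x))$ and $(s_M(x),next_M(x))$. -}

module Defs where

open import Data.Nat using (ℕ; zero; suc; _+_; _≤_; _<_)
open import Data.Fin using (Fin)
import Data.Fin
open import Data.Bool using (Bool; true; false; T)
open import Data.Sum using (_⊎_; inj₁; inj₂)
open import Data.Product using (_×_; Σ; ∃; _,_)
open import Data.Maybe using (Maybe; just; nothing)
open import Data.Vec using (Vec; lookup)
open import Data.Empty using (⊥)
open import Data.Unit using (⊤)
open import Relation.Nullary using (¬_)
open import Relation.Binary.PropositionalEquality using (_≡_; _≢_)

-- Vertices: students A = Fin nA (inj₁), schools B = Fin nB (inj₂).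

Vtx : ℕ → ℕ → Set
Vtx nA nB = Fin nA ⊎ Fin nB

adjB : ∀ {nA nB} → (Fin nA → Fin nB → Bool) → Vtx nA nB → Vtx nA nB → Bool
adjB E (inj₁ a) (inj₂ b) = E a b
adjB E (inj₂ b) (inj₁ a) = E a b
adjB E (inj₁ _) (inj₁ _) = false
adjB E (inj₂ _) (inj₂ _) = false

-- A stable assignment instance (G, <, q).
-- Convention: lt v y y' means  y <_v y'  (v strictly prefers y' to y).
record Instance : Set₁ where
  field
    nA nB : ℕ
    E     : Fin nA → Fin nB → Bool
    lt    : Vtx nA nB → Vtx nA nB → Vtx nA nB → Set
    lt-nbr   : ∀ v y y' → lt v y y' → T (adjB E v y) × T (adjB E v y')
    lt-irrefl : ∀ v y → ¬ lt v y y
    lt-trans : ∀ v y y' y'' → lt v y y' → lt v y' y'' → lt v y y''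
    lt-total : ∀ v y y' → T (adjB E v y) → T (adjB E v y') → y ≢ y' →
               lt v y y' ⊎ lt v y' y
    q     : Fin nB → ℕ
    q-pos : ∀ b → 1 ≤ q b

count : ∀ {n} → (Fin n → Bool) → ℕ
count {zero}  f = 0
count {suc n} f with f Data.Fin.zero
... | true  = suc (count (λ i → f (Data.Fin.suc i)))
... | false = count (λ i → f (Data.Fin.suc i))

module _ (I : Instance) where
  open Instance I

  V : Set
  V = Vtx nA nB

  adj : V → V → Set
  adj u v = T (adjB E u v)

  qV : V → ℕ
  qV (inj₁ _) = 1
  qV (inj₂ b) = q b

  -- A subset of A × B, represented canonically: row a is the subset of B.
  EdgeSet : Set
  EdgeSet = Vec (Vec Bool nB) nA

  memB : EdgeSet → Fin nA → Fin nB → Bool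
  memB M a b = lookup (lookup M a) b

  inM : EdgeSet → V → V → Set
  inM M (inj₁ a) (inj₂ b) = T (memB M a b)
  inM M (inj₂ b) (inj₁ a) = T (memB M a b)
  inM M (inj₁ _) (inj₁ _) = ⊥
  inM M (inj₂ _) (inj₂ _) = ⊥

  deg : EdgeSet → V → ℕ
  deg M (inj₁ a) = count (λ b → memB M a b)
  deg M (inj₂ b) = count (λ a → memB M a b)

  IsAssignment : EdgeSet → Set
  IsAssignment M = (∀ a b → T (memB M a b) → T (E a b)) × (∀ v → deg M v ≤ qV v)

  BlocksEdge : V → V → EdgeSet → Set
  BlocksEdge u v M =
    (∀ z → inM M u z → lt u z v) ×
    (deg M v < qV v ⊎ ∃ λ u' → inM M v u' × lt v u' u)

  Blocks : EdgeSet → EdgeSet → Set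
  Blocks L M = ∃ λ a → ∃ λ b → T (memB L a b) × BlocksEdge (inj₁ a) (inj₂ b) M

  IsStable : EdgeSet → Set
  IsStable M = IsAssignment M × (∀ a b → T (E a b) → ¬ BlocksEdge (inj₁ a) (inj₂ b) M)

  LegalSet : (EdgeSet → Set) → Set
  LegalSet 𝓛 = (∀ L → 𝓛 L → IsAssignment L) ×
    (∀ M → IsAssignment M → (¬ 𝓛 M → ∃ λ L → 𝓛 L × Blocks L M)
                          × ((∃ λ L → 𝓛 L × Blocks L M) → ¬ 𝓛 M))

  -- edge uv is illegal: it lies in no legal assignment
  -- (the legal set is unique, so we quantify over every set with the legal property)
  Illegal : V → V → Set₁
  Illegal u v = ∀ 𝓛 → LegalSet 𝓛 → ∀ L → 𝓛 L → ¬ inM L u v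

  data Side : Set where
    sideA sideB : Side

  InSide : Side → V → Set
  InSide sideA (inj₁ _) = ⊤
  InSide sideA (inj₂ _) = ⊥
  InSide sideB (inj₁ _) = ⊥
  InSide sideB (inj₂ _) = ⊤

  Cand : EdgeSet → V → V → Set
  Cand M x y = adj x y × ¬ inM M x y × ∃ λ x' → inM M y x' × lt y x' x

  IsS : EdgeSet → V → V → Set
  IsS M x y = Cand M x y × (∀ y' → Cand M x y' → y' ≡ y ⊎ lt x y' y)

  -- next_M(x) = n where y = s_M(x); nothing stands for ∅
  IsNext : EdgeSet → V → Maybe V → Set
  IsNext M y n =
    (deg M y ≡ qV y × ∃ λ z → n ≡ just z × inM M y z ×
                               (∀ z' → inM M y z' → z' ≡ z ⊎ lt y z z'))
    ⊎ (deg M y < qV y × n ≡ nothing)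

  -- arcs of the X-rotation digraph D_X of M (vertex set V ∪ {∅} = Maybe V)
  data Arc (X : Side) (M : EdgeSet) : Maybe V → Maybe V → Set where
    arc-s    : ∀ x y → InSide X x → IsS M x y → Arc X M (just x) (just y)
    arc-next : ∀ x y n → InSide X x → IsS M x y → IsNext M y n → Arc X M (just y) n

  Sink : Side → EdgeSet → V → Set
  Sink X M v = ∀ w → ¬ Arc X M (just v) w

module Submission where

-- A legal assignment L and the stable assignment M cannot block each other (M is legal up to
-- double negation). For two such assignments K₁, K₂ call a student preferring if its K₁-school
-- beats every K₂-school it has, and a school sought if it holds a preferring student in K₁. A
-- sought school is full in K₂ and ranks its K₂-newcomers above that student, so the newcomers
-- prefer K₁ as well; counting preferring students school by school and student by student then
-- forces equality throughout: whoever leaves a sought school prefers K₁, and every preferring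
-- student moves in K₂ to a sought school.
--
-- Suppose x′y ∈ L. If X = A, take K₁ = M, K₂ = L: x′ prefers M, so y is sought. Were x still at
-- y in L, the full school y would have to drop some M-member to admit x′; that member prefers M,
-- so y cannot rank it above x, against x being the worst member of M(y). So x leaves y, prefers M
-- and moves to a sought school w, which must rank its preferring M-member below x: w is a
-- candidate for s_M(x). If X = B, take K₁ = L, K₂ = M: y prefers L, so its M-school x is sought,
-- and the preferring student holding x in L is a candidate for s_M(x). Either way x is not a sink.

open import Level using (Level; 0ℓ)
open import Function using (_∘_)
open import Data.Nat using (ℕ; zero; suc; _+_; _≤_; _<_; z≤n; s≤s)
open import Data.Nat.Properties
  using ( ≤-refl; ≤-reflexive; ≤-trans; <-≤-trans; ≮⇒≥; <⇒≱
        ; +-mono-≤; +-mono-<-≤; +-mono-≤-<; +-monoʳ-≤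
        ; +-cancelˡ-≤; m≤m+n; m≤n+m; module ≤-Reasoning; +-0-commutativeMonoid)
open import Data.Fin using (Fin; zero; suc; punchIn; punchOut)
open import Data.Fin.Properties using (punchIn-punchOut; any?; all?; ¬∀⟶∃¬) renaming (_≟_ to _≟ᶠ_)
open import Data.Bool using (Bool; true; false; T; _∧_; not)
open import Data.Bool.Properties using (∧-comm)
open import Data.List using (List; _∷_; map; _++_; allFin)
open import Data.List.Relation.Unary.Any as Any using (Any; here; there)
open import Data.List.Membership.Propositional using (_∈_; lose; find)
open import Data.List.Membership.Propositional.Properties using (∈-allFin; ∈-map⁺; ∈-++⁺ˡ; ∈-++⁺ʳ)
open import Data.Maybe using (just)
open import Data.Product using (_×_; ∃; _,_; proj₁; proj₂)
open import Data.Sum using (_⊎_; inj₁; inj₂)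
open import Data.Sum.Properties using (≡-dec)
open import Data.Unit using (tt)
open import Data.Empty using (⊥)
open import Relation.Nullary using (¬_; Dec; yes; no; does; contradiction)
open import Relation.Nullary.Decidable using (T?; _×-dec_; _→-dec_; ¬?; map′; dec-false)
open import Relation.Unary using (Pred; Decidable; _∩_; _∖_; _⊆_)
open import Relation.Unary.Properties using (_∩?_; ∁?)
open import Relation.Binary using (Rel; Transitive; DecidableEquality)
open import Relation.Binary.PropositionalEquality using (_≡_; _≢_; refl; sym; trans; cong; cong₂; subst)
open import Algebra.Properties.CommutativeMonoid.Sum +-0-commutativeMonoid
  using (sum; ∑-comm; ∑-distrib-+; sum-remove; sum-cong-≗; sum-replicate-zero)

open import Defs

private variable
  m n : ℕ
  ℓ ℓ′ : Level
  P : Pred (Fin n) ℓ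
  Q : Pred (Fin n) ℓ′

sum-mono-≤ : {f g : Fin n → ℕ} → (∀ i → f i ≤ g i) → sum f ≤ sum g
sum-mono-≤ {zero}  f≤g = z≤n
sum-mono-≤ {suc n} f≤g = +-mono-≤ (f≤g zero) (sum-mono-≤ (f≤g ∘ suc))

sum-mono-< : {f g : Fin n → ℕ} → (∀ i → f i ≤ g i) → ∀ j → f j < g j → sum f < sum g
sum-mono-< f≤g zero    fj<gj = +-mono-<-≤ fj<gj (sum-mono-≤ (f≤g ∘ suc))
sum-mono-< f≤g (suc j) fj<gj = +-mono-≤-< (f≤g zero) (sum-mono-< (f≤g ∘ suc) j fj<gj)

sum-squeeze : {f g : Fin n → ℕ} → (∀ i → f i ≤ g i) → sum g ≤ sum f → ∀ i → g i ≤ f i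
sum-squeeze f≤g Σg≤Σf i = ≮⇒≥ λ fi<gi → <⇒≱ (sum-mono-< f≤g i fi<gi) Σg≤Σf

term≤sum : (f : Fin n → ℕ) (i : Fin n) → f i ≤ sum f
term≤sum f zero    = m≤m+n _ _
term≤sum f (suc i) = ≤-trans (term≤sum (f ∘ suc) i) (m≤n+m _ _)

pair≤sum : (f : Fin n → ℕ) {i j : Fin n} → i ≢ j → f i + f j ≤ sum f
pair≤sum {suc n} f {i} {j} i≢j = begin
  f i + f j                               ≡⟨ cong (λ k → f i + f k) (punchIn-punchOut i≢j) ⟨
  f i + f (punchIn i (punchOut i≢j))      ≤⟨ +-monoʳ-≤ (f i) (term≤sum (f ∘ punchIn i) (punchOut i≢j)) ⟩
  f i + sum (f ∘ punchIn i)               ≡⟨ sum-remove f ⟨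
  sum f                                   ∎
  where open ≤-Reasoning

double-counting-tight : (r : Fin m → ℕ) (w₁ w₂ : Fin m → Fin n → ℕ) →
  (∀ i → r i ≤ sum (w₁ i)) →
  (∀ j → sum (λ i → w₁ i j) ≤ sum (λ i → w₂ i j)) →
  (∀ i → sum (w₂ i) ≤ r i) →
  (∀ j → sum (λ i → w₂ i j) ≤ sum (λ i → w₁ i j)) × (∀ i → r i ≤ sum (w₂ i))
double-counting-tight r w₁ w₂ r≤rows₁ cols₁≤cols₂ rows₂≤r =
  sum-squeeze cols₁≤cols₂ Σcols₂≤Σcols₁ , sum-squeeze rows₂≤r Σr≤Σrows₂
  where
  open ≤-Reasoning
  Σr≤Σcols₁ : sum r ≤ sum (λ j → sum (λ i → w₁ i j))
  Σr≤Σcols₁ = begin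
    sum r                              ≤⟨ sum-mono-≤ r≤rows₁ ⟩
    sum (λ i → sum (w₁ i))             ≡⟨ ∑-comm w₁ ⟩
    sum (λ j → sum (λ i → w₁ i j))     ∎
  Σcols₂≤Σr : sum (λ j → sum (λ i → w₂ i j)) ≤ sum r
  Σcols₂≤Σr = begin
    sum (λ j → sum (λ i → w₂ i j))     ≡⟨ ∑-comm w₂ ⟨
    sum (λ i → sum (w₂ i))             ≤⟨ sum-mono-≤ rows₂≤r ⟩
    sum r                              ∎
  Σcols₂≤Σcols₁ : sum (λ j → sum (λ i → w₂ i j)) ≤ sum (λ j → sum (λ i → w₁ i j))
  Σcols₂≤Σcols₁ = ≤-trans Σcols₂≤Σr Σr≤Σcols₁
  Σr≤Σrows₂ : sum r ≤ sum (λ i → sum (w₂ i))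
  Σr≤Σrows₂ = begin
    sum r                              ≤⟨ ≤-trans Σr≤Σcols₁ (sum-mono-≤ cols₁≤cols₂) ⟩
    sum (λ j → sum (λ i → w₂ i j))     ≡⟨ ∑-comm w₂ ⟨
    sum (λ i → sum (w₂ i))             ∎

χ : Bool → ℕ
χ false = 0
χ true  = 1

#[_] : Decidable P → ℕ
#[ P? ] = sum (λ i → χ (does (P? i)))

count≡# : (f : Fin n → Bool) → count f ≡ #[ T? ∘ f ]
count≡# {zero}  f = refl
count≡# {suc n} f with f zero
... | true  = cong suc (count≡# (f ∘ suc))
... | false = count≡# (f ∘ suc)

χ-yes : {A : Set ℓ} (A? : Dec A) → A → χ (does A?) ≡ 1
χ-yes (yes _) _ = refl
χ-yes (no ¬a) a = contradiction a ¬a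

χ-mono : {A : Set ℓ} {B : Set ℓ′} (A? : Dec A) (B? : Dec B) → (A → B) → χ (does A?) ≤ χ (does B?)
χ-mono (yes a) (yes _) _   = ≤-refl
χ-mono (yes a) (no ¬b) a→b = contradiction (a→b a) ¬b
χ-mono (no _)  _       _   = z≤n

#-mono : (P? : Decidable P) (Q? : Decidable Q) → P ⊆ Q → #[ P? ] ≤ #[ Q? ]
#-mono P? Q? P⊆Q = sum-mono-≤ λ i → χ-mono (P? i) (Q? i) P⊆Q

#-mono-< : (P? : Decidable P) (Q? : Decidable Q) → P ⊆ Q → ∀ {j} → Q j → ¬ P j → #[ P? ] < #[ Q? ]
#-mono-< {P = P} {Q = Q} P? Q? P⊆Q {j} qj ¬pj = sum-mono-< (λ i → χ-mono (P? i) (Q? i) P⊆Q) j (strict (P? j) (Q? j))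
  where
  strict : (pj? : Dec (P j)) (qj? : Dec (Q j)) → χ (does pj?) < χ (does qj?)
  strict (no _)   (yes _)  = s≤s z≤n
  strict (yes pj) _        = contradiction pj ¬pj
  strict _        (no ¬qj) = contradiction qj ¬qj

#-empty : ∀ {n} {P : Pred (Fin n) ℓ} (P? : Decidable P) → (∀ i → ¬ P i) → #[ P? ] ≡ 0
#-empty {n = n} P? ∄P = trans (sum-cong-≗ λ i → cong χ (dec-false (P? i) (∄P i))) (sum-replicate-zero n)

#-pos : (P? : Decidable P) → ∀ {i} → P i → 1 ≤ #[ P? ]
#-pos P? {i} pi = subst (_≤ #[ P? ]) (χ-yes (P? i) pi) (term≤sum _ i)

#-pos⇒∃ : (P? : Decidable P) → 1 ≤ #[ P? ] → ∃ P
#-pos⇒∃ P? 1≤# with any? P?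
... | yes ∃P = ∃P
... | no ∄P  = contradiction (subst (1 ≤_) (#-empty P? λ i pi → ∄P (i , pi)) 1≤#) λ ()

#≤1⇒unique : (P? : Decidable P) → #[ P? ] ≤ 1 → ∀ {i j} → P i → P j → i ≡ j
#≤1⇒unique P? #≤1 {i} {j} pi pj with i ≟ᶠ j
... | yes i≡j = i≡j
... | no  i≢j = contradiction 2≤1 λ { (s≤s ()) }
  where
  open ≤-Reasoning
  2≤1 : 2 ≤ 1
  2≤1 = begin
    2                                        ≡⟨ cong₂ _+_ (χ-yes (P? i) pi) (χ-yes (P? j) pj) ⟨
    χ (does (P? i)) + χ (does (P? j))        ≤⟨ pair≤sum _ i≢j ⟩
    #[ P? ]                                  ≤⟨ #≤1 ⟩
    1                                        ∎

#-split : (P? : Decidable P) (Q? : Decidable Q) → #[ P? ∩? Q? ] + #[ P? ∩? ∁? Q? ] ≡ #[ P? ]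
#-split P? Q? =
  trans (sym (∑-distrib-+ (λ i → χ (does ((P? ∩? Q?) i))) (λ i → χ (does ((P? ∩? ∁? Q?) i)))))
        (sum-cong-≗ λ i → split (does (P? i)) (does (Q? i)))
  where
  split : ∀ b c → χ (b ∧ c) + χ (b ∧ not c) ≡ χ b
  split false _     = refl
  split true  true  = refl
  split true  false = refl

#-∩-comm : (P? : Decidable P) (Q? : Decidable Q) → #[ P? ∩? Q? ] ≡ #[ Q? ∩? P? ]
#-∩-comm P? Q? = sum-cong-≗ λ i → cong χ (∧-comm (does (P? i)) (does (Q? i)))

#-∖-mono : (P? : Decidable P) (Q? : Decidable Q) → #[ P? ] ≤ #[ Q? ] → #[ P? ∩? ∁? Q? ] ≤ #[ Q? ∩? ∁? P? ]
#-∖-mono P? Q? #P≤#Q = +-cancelˡ-≤ #[ P? ∩? Q? ] _ _ (begin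
  #[ P? ∩? Q? ] + #[ P? ∩? ∁? Q? ]    ≡⟨ #-split P? Q? ⟩
  #[ P? ]                             ≤⟨ #P≤#Q ⟩
  #[ Q? ]                             ≡⟨ #-split Q? P? ⟨
  #[ Q? ∩? P? ] + #[ Q? ∩? ∁? P? ]    ≡⟨ cong (_+ #[ Q? ∩? ∁? P? ]) (#-∩-comm Q? P?) ⟩
  #[ P? ∩? Q? ] + #[ Q? ∩? ∁? P? ]    ∎)
  where open ≤-Reasoning

#-exchange : (P? : Decidable P) (Q? : Decidable Q) → #[ Q? ] ≤ #[ P? ] →
             ∀ {j} → Q j → ¬ P j → ∃ λ i → P i × ¬ Q i
#-exchange {P = P} {Q = Q} P? Q? #Q≤#P qj ¬pj with any? (P? ∩? ∁? Q?)
... | yes P∖Q = P∖Q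
... | no  ∄P∖Q = contradiction #Q≤#P (<⇒≱ (#-mono-< P? Q? P⊆Q qj ¬pj))
  where
  P⊆Q : P ⊆ Q
  P⊆Q {i} pi with Q? i
  ... | yes qi = qi
  ... | no ¬qi = contradiction (i , pi , ¬qi) ∄P∖Q

module _ {a p r : Level} {A : Set a} {P : Pred A p} (P? : Decidable P)
         {_<_ : Rel A r} (<-trans : Transitive _<_)
         (compare : ∀ {x y} → P x → P y → (x ≡ y ⊎ x < y) ⊎ y < x) where

  MaximumOn : List A → A → Set _
  MaximumOn xs m = P m × ∀ {y} → y ∈ xs → P y → y ≡ m ⊎ y < m

  maximumOn : ∀ xs → Any P xs → ∃ (MaximumOn xs)
  maximumOn (x ∷ xs) P[x∷xs] with Any.any? P? xs
  ... | no ¬P[xs] = x , px P[x∷xs] , bound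
    where
    px : Any P (x ∷ xs) → P x
    px (here px)       = px
    px (there P[xs])   = contradiction P[xs] ¬P[xs]
    bound : ∀ {y} → y ∈ x ∷ xs → P y → y ≡ x ⊎ y < x
    bound (here refl)   _  = inj₁ refl
    bound (there y∈xs)  py = contradiction (lose y∈xs py) ¬P[xs]
  ... | yes P[xs] with maximumOn xs P[xs] | P? x
  ...   | m , pm , bound | no ¬px = m , pm , λ where
    (here refl)  px → contradiction px ¬px
    (there y∈xs)    → bound y∈xs
  ...   | m , pm , bound | yes px with compare px pm
  ...     | inj₁ x≤m = m , pm , λ where
    (here refl) _ → x≤m
    (there y∈xs)  → bound y∈xs
  ...     | inj₂ m<x = x , px , below-x
    where
    below-x : ∀ {y} → y ∈ x ∷ xs → P y → y ≡ x ⊎ y < x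
    below-x (here refl)  _  = inj₁ refl
    below-x (there y∈xs) py with bound y∈xs py
    ... | inj₁ refl = inj₂ m<x
    ... | inj₂ y<m  = inj₂ (<-trans y<m m<x)

  maximum : (xs : List A) → (∀ y → y ∈ xs) → ∃ P → ∃ λ m → P m × ∀ y → P y → y ≡ m ⊎ y < m
  maximum xs complete (y , py) with maximumOn xs (lose (complete y) py)
  ... | m , pm , bound = m , pm , λ z → bound (complete z)

module _ (I : Instance) where
  open Instance I

  _≟ⱽ_ : DecidableEquality (V I)
  _≟ⱽ_ = ≡-dec _≟ᶠ_ _≟ᶠ_

  allV : List (V I)
  allV = map inj₁ (allFin nA) ++ map inj₂ (allFin nB)

  ∈-allV : ∀ v → v ∈ allV
  ∈-allV (inj₁ a) = ∈-++⁺ˡ (∈-map⁺ inj₁ (∈-allFin a))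
  ∈-allV (inj₂ b) = ∈-++⁺ʳ (map inj₁ (allFin nA)) (∈-map⁺ inj₂ (∈-allFin b))

  any?ⱽ : {P : Pred (V I) 0ℓ} → Decidable P → Dec (∃ P)
  any?ⱽ P? = map′ (λ P[allV] → let v , _ , pv = find P[allV] in v , pv)
                  (λ (v , pv) → lose (∈-allV v) pv)
                  (Any.any? P? allV)

  lt-flip : ∀ v y y′ → adj I v y → adj I v y′ → y ≢ y′ → ¬ lt v y y′ → lt v y′ y
  lt-flip v y y′ v~y v~y′ y≢y′ y≮y′ with lt-total v y y′ v~y v~y′ y≢y′
  ... | inj₁ y<y′ = contradiction y<y′ y≮y′
  ... | inj₂ y′<y = y′<y

  lt? : ∀ v y y′ → Dec (lt v y y′)
  lt? v y y′ with T? (adjB E v y) | T? (adjB E v y′) | y ≟ⱽ y′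
  ... | no ¬v~y | _        | _    = no (¬v~y ∘ proj₁ ∘ lt-nbr v y y′)
  ... | yes _   | no ¬v~y′ | _    = no (¬v~y′ ∘ proj₂ ∘ lt-nbr v y y′)
  ... | yes _   | yes _    | yes refl = no (lt-irrefl v y)
  ... | yes v~y | yes v~y′ | no y≢y′ with lt-total v y y′ v~y v~y′ y≢y′
  ...   | inj₁ y<y′ = yes y<y′
  ...   | inj₂ y′<y = no λ y<y′ → lt-irrefl v y (lt-trans v y y′ y y<y′ y′<y)

  inM? : ∀ K u v → Dec (inM I K u v)
  inM? K (inj₁ a) (inj₂ b) = T? (memB I K a b)
  inM? K (inj₂ b) (inj₁ a) = T? (memB I K a b)
  inM? K (inj₁ _) (inj₁ _) = no λ ()
  inM? K (inj₂ _) (inj₂ _) = no λ ()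

  Assigned : EdgeSet I → Fin nA → Fin nB → Set
  Assigned K a b = T (memB I K a b)

  Assigned? : ∀ K a b → Dec (Assigned K a b)
  Assigned? K a b = T? (memB I K a b)

  Members : EdgeSet I → Fin nB → Pred (Fin nA) 0ℓ
  Members K b a = Assigned K a b

  members? : ∀ K b → Decidable (Members K b)
  members? K b a = Assigned? K a b

  Improves : EdgeSet I → Fin nA → Fin nB → Set
  Improves K a b = ∀ b′ → Assigned K a b′ → lt (inj₁ a) (inj₂ b′) (inj₂ b)

  NonBlocking : EdgeSet I → EdgeSet I → Set
  NonBlocking K K′ = ∀ a b → Assigned K a b → ¬ BlocksEdge I (inj₁ a) (inj₂ b) K′

  deg≡#members : ∀ K b → deg I K (inj₂ b) ≡ #[ members? K b ]
  deg≡#members K b = count≡# (λ a → memB I K a b)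

  module _ {K : EdgeSet I} (K-assignment : IsAssignment I K) where

    assigned⇒adj : ∀ {a b} → Assigned K a b → adj I (inj₁ a) (inj₂ b)
    assigned⇒adj = proj₁ K-assignment _ _

    #members≤quota : ∀ b → #[ members? K b ] ≤ q b
    #members≤quota b = subst (_≤ q b) (deg≡#members K b) (proj₂ K-assignment (inj₂ b))

    #partners≤1 : ∀ a → #[ Assigned? K a ] ≤ 1
    #partners≤1 a = subst (_≤ 1) (count≡# (memB I K a)) (proj₂ K-assignment (inj₁ a))

    #members≤full : ∀ {K′ b} → deg I K′ (inj₂ b) ≡ q b → #[ members? K b ] ≤ #[ members? K′ b ]
    #members≤full {K′} {b} full =
      ≤-trans (#members≤quota b) (≤-reflexive (trans (sym full) (deg≡#members K′ b)))

    partner-unique : ∀ {a b b′} → Assigned K a b → Assigned K a b′ → b ≡ b′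
    partner-unique {a} = #≤1⇒unique (Assigned? K a) (#partners≤1 a)

    improves-partner : ∀ {a b b₀} → Assigned K a b → lt (inj₁ a) (inj₂ b) (inj₂ b₀) → Improves K a b₀
    improves-partner a~b b<b₀ b′ a~b′ = subst (λ b → lt _ (inj₂ b) _) (partner-unique a~b a~b′) b<b₀

  improves-on-every-partner : ∀ {K a b} → Improves K a b →
                              ∀ z → inM I K (inj₁ a) z → lt (inj₁ a) z (inj₂ b)
  improves-on-every-partner imp (inj₂ b′) = imp b′

  unblocked-school : ∀ K K′ {a b} → NonBlocking K K′ → Assigned K a b → Improves K′ a b →
                     q b ≤ deg I K′ (inj₂ b) ×
                     (∀ u → Assigned K′ u b → ¬ lt (inj₂ b) (inj₁ u) (inj₁ a))
  unblocked-school K K′ K↛K′ a~b imp =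
    ≮⇒≥ (λ vacancy → K↛K′ _ _ a~b (improves-on-every-partner imp , inj₁ vacancy)) ,
    λ u u~b u<a → K↛K′ _ _ a~b (improves-on-every-partner imp , inj₂ (inj₁ u , u~b , u<a))

  unblocked-student : ∀ K K′ {u a b} → IsAssignment I K → IsAssignment I K′ → NonBlocking K′ K →
                      Assigned K′ u b → ¬ Assigned K u b → Assigned K a b → lt (inj₂ b) (inj₁ a) (inj₁ u) →
                      ∃ λ b₀ → Assigned K u b₀ × lt (inj₁ u) (inj₂ b) (inj₂ b₀)
  unblocked-student K K′ {u = u} {b = b} K-assignment K′-assignment K′↛K u~b u≁b a~b a<u
    with ¬∀⟶∃¬ nB _ (λ b′ → Assigned? K u b′ →-dec lt? (inj₁ u) (inj₂ b′) (inj₂ b))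
               (λ imp → K′↛K _ _ u~b (improves-on-every-partner imp , inj₂ (inj₁ _ , a~b , a<u)))
  ... | b₀ , ¬[u~b₀⇒b₀<b] with Assigned? K u b₀
  ...   | no u≁b₀ = contradiction (λ u~b₀ → contradiction u~b₀ u≁b₀) ¬[u~b₀⇒b₀<b]
  ...   | yes u~b₀ = b₀ , u~b₀ ,
            lt-flip (inj₁ u) (inj₂ b₀) (inj₂ b)
                    (assigned⇒adj K-assignment u~b₀) (assigned⇒adj K′-assignment u~b)
                    (λ { refl → u≁b u~b₀ }) (λ b₀<b → ¬[u~b₀⇒b₀<b] (λ _ → b₀<b))

  module Comparison {K₁ K₂ : EdgeSet I} (K₁-assignment : IsAssignment I K₁) (K₂-assignment : IsAssignment I K₂)
                    (K₁↛K₂ : NonBlocking K₁ K₂) (K₂↛K₁ : NonBlocking K₂ K₁) where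

    Prefers : Pred (Fin nA) 0ℓ
    Prefers a = ∃ λ b → Assigned K₁ a b × Improves K₂ a b

    Prefers? : Decidable Prefers
    Prefers? a = any? λ b → Assigned? K₁ a b ×-dec
                             all? λ b′ → Assigned? K₂ a b′ →-dec lt? (inj₁ a) (inj₂ b′) (inj₂ b)

    Sought : Pred (Fin nB) 0ℓ
    Sought b = ∃ λ a → Prefers a × Assigned K₁ a b

    Sought? : Decidable Sought
    Sought? b = any? λ a → Prefers? a ×-dec Assigned? K₁ a b

    prefers-improves : ∀ {a b} → Prefers a → Assigned K₁ a b → Improves K₂ a b
    prefers-improves (b₀ , a~b₀ , imp) a~b with partner-unique K₁-assignment a~b₀ a~b
    ... | refl = imp

    prefers⇒unassigned₂ : ∀ {a b} → Prefers a → Assigned K₁ a b → ¬ Assigned K₂ a b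
    prefers⇒unassigned₂ {b = b} pa a~b a~₂b = lt-irrefl _ _ (prefers-improves pa a~b b a~₂b)

    prefers⇒full : ∀ {a b} → Prefers a → Assigned K₁ a b → q b ≤ #[ members? K₂ b ]
    prefers⇒full {b = b} pa a~b =
      subst (q b ≤_) (deg≡#members K₂ b)
            (proj₁ (unblocked-school K₁ K₂ K₁↛K₂ a~b (prefers-improves pa a~b)))

    prefers⇒outranked : ∀ {a u b} → Prefers a → Assigned K₁ a b → Assigned K₂ u b →
                        ¬ lt (inj₂ b) (inj₁ u) (inj₁ a)
    prefers⇒outranked pa a~b = proj₂ (unblocked-school K₁ K₂ K₁↛K₂ a~b (prefers-improves pa a~b)) _

    prefers-if-outranks : ∀ {u a b} → Assigned K₂ u b → ¬ Assigned K₁ u b → Assigned K₁ a b →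
                          lt (inj₂ b) (inj₁ a) (inj₁ u) → Prefers u
    prefers-if-outranks u~₂b u≁b a~b a<u
      with unblocked-student K₁ K₂ K₁-assignment K₂-assignment K₂↛K₁ u~₂b u≁b a~b a<u
    ... | b₀ , u~b₀ , b<b₀ = b₀ , u~b₀ , improves-partner K₂-assignment u~₂b b<b₀

    sought-newcomer-prefers : ∀ {u b} → Sought b → Assigned K₂ u b → ¬ Assigned K₁ u b → Prefers u
    sought-newcomer-prefers {u} {b} (a , pa , a~b) u~₂b u≁b = prefers-if-outranks u~₂b u≁b a~b a<u
      where
      a<u : lt (inj₂ b) (inj₁ a) (inj₁ u)
      a<u = lt-flip (inj₂ b) (inj₁ u) (inj₁ a)
                    (assigned⇒adj K₂-assignment u~₂b) (assigned⇒adj K₁-assignment a~b)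
                    (λ { refl → u≁b a~b }) (prefers⇒outranked pa a~b u~₂b)

    Arrival : Fin nA → Fin nB → Set
    Arrival a b = Prefers a × Sought b × Assigned K₂ a b

    arrival? : ∀ b → Decidable (λ a → Arrival a b)
    arrival? b a = Prefers? a ×-dec Sought? b ×-dec Assigned? K₂ a b

    leaving? : ∀ b → Decidable (Members K₁ b ∖ Members K₂ b)
    leaving? b = members? K₁ b ∩? ∁? (members? K₂ b)

    joining? : ∀ b → Decidable (Members K₂ b ∖ Members K₁ b)
    joining? b = members? K₂ b ∩? ∁? (members? K₁ b)

    sought-#leaving≤#arriving : ∀ {b} → Sought b → #[ leaving? b ] ≤ #[ arrival? b ]
    sought-#leaving≤#arriving {b} sb@(a , pa , a~b) = begin
      #[ leaving? b ]   ≤⟨ #-∖-mono (members? K₁ b) (members? K₂ b) K₁b≤K₂b ⟩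
      #[ joining? b ]   ≤⟨ #-mono (joining? b) (arrival? b) joining⇒arrival ⟩
      #[ arrival? b ]   ∎
      where
      open ≤-Reasoning
      K₁b≤K₂b : #[ members? K₁ b ] ≤ #[ members? K₂ b ]
      K₁b≤K₂b = ≤-trans (#members≤quota K₁-assignment b) (prefers⇒full pa a~b)
      joining⇒arrival : Members K₂ b ∖ Members K₁ b ⊆ λ u → Arrival u b
      joining⇒arrival (u~₂b , u≁b) = sought-newcomer-prefers sb u~₂b u≁b , sb , u~₂b

    -- Each preferring student leaves some school, arrives at no more than one, and no school loses
    -- more preferring students than arrive at it; so all these counts agree.
    private
      prefers⇒leaving : ∀ {b} → Prefers ∩ Members K₁ b ⊆ Members K₁ b ∖ Members K₂ b
      prefers⇒leaving (pa , a~b) = a~b , prefers⇒unassigned₂ pa a~b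

      #preferring-leaving≤#arriving : ∀ b → #[ Prefers? ∩? members? K₁ b ] ≤ #[ arrival? b ]
      #preferring-leaving≤#arriving b = from (Sought? b)
        where
        from : Dec (Sought b) → #[ Prefers? ∩? members? K₁ b ] ≤ #[ arrival? b ]
        from (yes sb) = ≤-trans (#-mono (Prefers? ∩? members? K₁ b) (leaving? b) prefers⇒leaving)
                                (sought-#leaving≤#arriving sb)
        from (no ¬sb) = ≤-trans (≤-reflexive (#-empty (Prefers? ∩? members? K₁ b) not-sought)) z≤n
          where
          not-sought : ∀ a → ¬ (Prefers a × Assigned K₁ a b)
          not-sought a (pa , a~b) = ¬sb (a , pa , a~b)

      prefers≤#leaving : ∀ a → χ (does (Prefers? a)) ≤ #[ (λ b → Prefers? a ×-dec Assigned? K₁ a b) ]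
      prefers≤#leaving a with Prefers? a
      ... | yes pa@(b , a~b , _) = #-pos (λ b → yes pa ×-dec Assigned? K₁ a b) (pa , a~b)
      ... | no _ = z≤n

      #arriving≤prefers : ∀ a → #[ (λ b → Prefers? a ×-dec Sought? b ×-dec Assigned? K₂ a b) ] ≤
                                χ (does (Prefers? a))
      #arriving≤prefers a with Prefers? a
      ... | yes pa = ≤-trans (#-mono (λ b → yes pa ×-dec Sought? b ×-dec Assigned? K₂ a b) (Assigned? K₂ a)
                                     (proj₂ ∘ proj₂))
                             (#partners≤1 K₂-assignment a)
      ... | no ¬pa = ≤-reflexive (#-empty (λ b → no ¬pa ×-dec Sought? b ×-dec Assigned? K₂ a b)
                                          λ _ → ¬pa ∘ proj₁)

      tight : (∀ b → #[ arrival? b ] ≤ #[ Prefers? ∩? members? K₁ b ]) ×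
              (∀ a → χ (does (Prefers? a)) ≤ #[ (λ b → arrival? b a) ])
      tight = double-counting-tight (λ a → χ (does (Prefers? a)))
                (λ a b → χ (does (Prefers? a ×-dec Assigned? K₁ a b)))
                (λ a b → χ (does (arrival? b a)))
                prefers≤#leaving #preferring-leaving≤#arriving #arriving≤prefers

    sought-leaver-prefers : ∀ {a b} → Sought b → Assigned K₁ a b → ¬ Assigned K₂ a b → Prefers a
    sought-leaver-prefers {a} {b} sb a~b a≁₂b with Prefers? a
    ... | yes pa = pa
    ... | no ¬pa =
      contradiction (proj₁ tight b) (<⇒≱ (<-≤-trans #preferring<#leaving (sought-#leaving≤#arriving sb)))
      where
      #preferring<#leaving : #[ Prefers? ∩? members? K₁ b ] < #[ leaving? b ]
      #preferring<#leaving = #-mono-< (Prefers? ∩? members? K₁ b) (leaving? b) prefers⇒leaving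
                                      (a~b , a≁₂b) (¬pa ∘ proj₁)

    prefers⇒sought₂ : ∀ {a} → Prefers a → ∃ λ b → Assigned K₂ a b × Sought b
    prefers⇒sought₂ {a} pa with #-pos⇒∃ (λ b → arrival? b a)
                                 (≤-trans (≤-reflexive (sym (χ-yes (Prefers? a) pa))) (proj₂ tight a))
    ... | b , _ , sb , a~₂b = b , a~₂b , sb

    sought-if-outranks : ∀ {u a b} → Assigned K₂ u b → ¬ Assigned K₁ u b → Assigned K₁ a b →
                         lt (inj₂ b) (inj₁ a) (inj₁ u) → Sought b
    sought-if-outranks u~₂b u≁b a~b a<u with prefers⇒sought₂ (prefers-if-outranks u~₂b u≁b a~b a<u)
    ... | b′ , u~₂b′ , sb′ = subst Sought (sym (partner-unique K₂-assignment u~₂b u~₂b′)) sb′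

  stable-unblocked : ∀ {M L} → IsStable I M → IsAssignment I L → NonBlocking L M
  stable-unblocked M-stable L-assignment a b a~b = proj₂ M-stable a b (proj₁ L-assignment a b a~b)

  legal-unblocked : ∀ {M 𝓛 L} → IsStable I M → LegalSet I 𝓛 → 𝓛 L → NonBlocking L M × NonBlocking M L
  legal-unblocked {M} {𝓛} {L} M-stable (legal⇒assignment , legality) L∈𝓛 =
    stable-unblocked M-stable L-assignment ,
    λ a b a~b blocks → ¬¬M∈𝓛 λ M∈𝓛 →
      proj₂ (legality L L-assignment) (M , M∈𝓛 , a , b , a~b , blocks) L∈𝓛
    where
    L-assignment : IsAssignment I L
    L-assignment = legal⇒assignment L L∈𝓛
    ¬¬M∈𝓛 : ¬ ¬ 𝓛 M
    ¬¬M∈𝓛 M∉𝓛 with proj₁ (legality M (proj₁ M-stable)) M∉𝓛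
    ... | L′ , L′∈𝓛 , a , b , a~b , blocks =
      stable-unblocked M-stable (legal⇒assignment L′ L′∈𝓛) a b a~b blocks

  next-worst-member : ∀ {M y z} → IsNext I M y (just z) →
                      deg I M y ≡ qV I y × inM I M y z × (∀ z′ → inM I M y z′ → z′ ≡ z ⊎ lt y z z′)
  next-worst-member (inj₁ (full , _ , refl , y~z , worst)) = full , y~z , worst

  candidate⇒¬sink : ∀ {X M x y} → InSide I X x → Cand I M x y → ¬ Sink I X M x
  candidate⇒¬sink {X} {M} {x} x∈X cand sink
    with maximum Cand? (λ {y₁ y₂ y₃} → lt-trans x y₁ y₂ y₃) compare allV ∈-allV (_ , cand)
    where
    Cand? : Decidable (Cand I M x)
    Cand? y = T? (adjB E x y) ×-dec ¬? (inM? M x y) ×-dec any?ⱽ λ x′ → inM? M y x′ ×-dec lt? y x′ x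
    compare : ∀ {y₁ y₂} → Cand I M x y₁ → Cand I M x y₂ → (y₁ ≡ y₂ ⊎ lt x y₁ y₂) ⊎ lt x y₂ y₁
    compare {y₁} {y₂} (x~y₁ , _) (x~y₂ , _) with y₁ ≟ⱽ y₂
    ... | yes y₁≡y₂ = inj₁ (inj₁ y₁≡y₂)
    ... | no y₁≢y₂ with lt-total x y₁ y₂ x~y₁ x~y₂ y₁≢y₂
    ...   | inj₁ y₁<y₂ = inj₁ (inj₂ y₁<y₂)
    ...   | inj₂ y₂<y₁ = inj₂ y₂<y₁
  ... | best , best-cand , above = sink (just best) (arc-s x best x∈X (best-cand , above))

  adj⇒other-side : ∀ {X u v} → InSide I X u → adj I u v → ¬ InSide I X v
  adj⇒other-side {sideA} {inj₁ _} {inj₂ _} _ _ ()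
  adj⇒other-side {sideB} {inj₂ _} {inj₁ _} _ _ ()

  assigned⇒straddles : ∀ {X M u v} → inM I M u v → InSide I X u ⊎ InSide I X v
  assigned⇒straddles {sideA} {u = inj₁ _} {inj₂ _} _ = inj₁ tt
  assigned⇒straddles {sideA} {u = inj₂ _} {inj₁ _} _ = inj₂ tt
  assigned⇒straddles {sideB} {u = inj₁ _} {inj₂ _} _ = inj₂ tt
  assigned⇒straddles {sideB} {u = inj₂ _} {inj₁ _} _ = inj₁ tt

  path-into : ∀ {X M x x′ y} → InSide I X x → Arc I X M (just x′) (just y) → Arc I X M (just y) (just x) →
              InSide I X x′ × Cand I M x′ y × IsNext I M y (just x)
  path-into x∈X _ (arc-s _ _ y∈X ((y~x , _) , _)) = contradiction x∈X (adj⇒other-side y∈X y~x)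
  path-into x∈X (arc-s _ _ x′∈X (cand , _)) (arc-next _ _ _ _ _ next) = x′∈X , cand , next
  path-into {X} x∈X (arc-next _ _ _ x₁∈X ((x₁~x′ , _) , _) next′) (arc-next _ _ _ x₀∈X ((x₀~y , _) , _) _)
    with assigned⇒straddles {X} (proj₁ (proj₂ (next-worst-member next′)))
  ... | inj₁ x′∈X = contradiction x′∈X (adj⇒other-side x₁∈X x₁~x′)
  ... | inj₂ y∈X  = contradiction y∈X (adj⇒other-side x₀∈X x₀~y)

  module _ {M L : EdgeSet I} (M-stable : IsStable I M) (L-assignment : IsAssignment I L)
           (L↛M : NonBlocking L M) (M↛L : NonBlocking M L) where

    private
      M-assignment : IsAssignment I M
      M-assignment = proj₁ M-stable
      module ML = Comparison M-assignment L-assignment M↛L L↛M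
      module LM = Comparison L-assignment M-assignment L↛M M↛L

    sought-school-loses-next : ∀ {x x′ y} → ML.Sought y → IsNext I M (inj₂ y) (just (inj₁ x)) →
                               Assigned L x′ y → ¬ Assigned M x′ y → ¬ Assigned L x y
    sought-school-loses-next {x} {x′} {y} sy next x′~ᴸy x′≁y x~ᴸy with next-worst-member next
    ... | full , _ , worst
      with #-exchange (members? M y) (members? L y) (#members≤full L-assignment {M} full) x′~ᴸy x′≁y
    ...   | a , a~y , a≁ᴸy with worst (inj₁ a) a~y
    ...     | inj₁ refl = a≁ᴸy x~ᴸy
    ...     | inj₂ x<a  = ML.prefers⇒outranked (ML.sought-leaver-prefers sy a~y a≁ᴸy) a~y x~ᴸy x<a

    sought-leaver-has-candidate : ∀ {x y} → ML.Sought y → Assigned M x y → ¬ Assigned L x y →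
                                  ∃ (Cand I M (inj₁ x))
    sought-leaver-has-candidate {x} {y} sy x~y x≁ᴸy
      with ML.prefers⇒sought₂ (ML.sought-leaver-prefers sy x~y x≁ᴸy)
    ... | w , x~ᴸw , (a , pa , a~w) = inj₂ w , assigned⇒adj L-assignment x~ᴸw , x≁w , inj₁ a , a~w , a<x
      where
      x≁w : ¬ Assigned M x w
      x≁w x~w = x≁ᴸy (subst (Assigned L x) (sym (partner-unique M-assignment x~y x~w)) x~ᴸw)
      a<x : lt (inj₂ w) (inj₁ a) (inj₁ x)
      a<x = lt-flip (inj₂ w) (inj₁ x) (inj₁ a) (assigned⇒adj L-assignment x~ᴸw) (assigned⇒adj M-assignment a~w)
                    (λ { refl → x≁w a~w }) (ML.prefers⇒outranked pa a~w x~ᴸw)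

    sought-school-has-candidate : ∀ {x} → LM.Sought x → ∃ (Cand I M (inj₂ x))
    sought-school-has-candidate (a , pa , a~ᴸx) with LM.prefers⇒sought₂ pa
    ... | b , a~b , _ = inj₁ a , assigned⇒adj L-assignment a~ᴸx , LM.prefers⇒unassigned₂ pa a~ᴸx ,
                        inj₂ b , a~b , LM.prefers-improves pa a~ᴸx b a~b

    student-sink-case : ∀ {x x′ y} → Cand I M (inj₁ x′) (inj₂ y) → IsNext I M (inj₂ y) (just (inj₁ x)) →
                        Sink I sideA M (inj₁ x) → ¬ Assigned L x′ y
    student-sink-case {x} {x′} {y} (_ , x′≁y , inj₁ a , a~y , a<x′) next sink x′~ᴸy =
      by-cases (Assigned? L x y)
      where
      y-sought : ML.Sought y
      y-sought = ML.sought-if-outranks x′~ᴸy x′≁y a~y a<x′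
      by-cases : Dec (Assigned L x y) → ⊥
      by-cases (yes x~ᴸy) = sought-school-loses-next y-sought next x′~ᴸy x′≁y x~ᴸy
      by-cases (no x≁ᴸy)  = candidate⇒¬sink tt (proj₂ (sought-leaver-has-candidate y-sought x~y x≁ᴸy)) sink
        where
        x~y : Assigned M x y
        x~y = proj₁ (proj₂ (next-worst-member next))

    school-sink-case : ∀ {x x′ y} → Cand I M (inj₂ x′) (inj₁ y) → IsNext I M (inj₁ y) (just (inj₂ x)) →
                       Sink I sideB M (inj₂ x) → ¬ Assigned L y x′
    school-sink-case {x} {x′} {y} (_ , _ , inj₂ b , y~b , b<x′) next sink y~ᴸx′
      with LM.prefers⇒sought₂ (_ , y~ᴸx′ , improves-partner M-assignment y~b b<x′)
    ... | x₀ , y~x₀ , x₀-sought = candidate⇒¬sink tt (proj₂ (sought-school-has-candidate x-sought)) sink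
      where
      y~x : Assigned M y x
      y~x = proj₁ (proj₂ (next-worst-member next))
      x-sought : LM.Sought x
      x-sought = subst LM.Sought (sym (partner-unique M-assignment y~x y~x₀)) x₀-sought

    sink-predecessor-unassigned : ∀ {X x x′ y} → InSide I X x → Sink I X M x → InSide I X x′ →
                                  Cand I M x′ y → IsNext I M y (just x) → ¬ inM I L x′ y
    sink-predecessor-unassigned {sideA} {inj₁ _} {inj₁ _} {inj₂ _} _ sink _ cand next =
      student-sink-case cand next sink
    sink-predecessor-unassigned {sideB} {inj₂ _} {inj₂ _} {inj₁ _} _ sink _ cand next =
      school-sink-case cand next sink

lemma7 : (I : Instance) (X : Side I) (M : EdgeSet I) → IsStable I M →
         (x x' y : V I) → InSide I X x → Sink I X M x →
         Arc I X M (just x') (just y) → Arc I X M (just y) (just x) →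
         Illegal I x' y
lemma7 I X M M-stable x x' y x∈X sink arc₁ arc₂ 𝓛 legal L L∈𝓛
  with path-into I x∈X arc₁ arc₂ | legal-unblocked I M-stable legal L∈𝓛
... | x'∈X , cand , next | L↛M , M↛L =
  sink-predecessor-unassigned I M-stable (proj₁ legal L L∈𝓛) L↛M M↛L x∈X sink x'∈X cand next
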